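{- Let $(W,S)$ be a simply-laced triangle-free Coxeter system. If ${\boldsymbol{\alpha}}$ and ${\boldsymbol{\beta}}$ are braid equivalent links of rank $r\ge0$, then there is an automorphism $F:\{0,1\}^r\to\{0,1\}^r$ of the hypercube $Q_r$ satisfying $F\circ\Phi_{{\boldsymbol{\alpha}}}=\Phi_{{\boldsymbol{\beta}}}$. In particular, $\Phi_{{\boldsymbol{\alpha}}}$ is an isometric embedding of $B({\boldsymbol{\alpha}})$ into $Q_r$ if and only if $\Phi_{{\boldsymbol{\beta}}}$ is.
   Context: A Coxeter system $(W,S)$: finite $S$, $W=\langle S\mid (st)^{m(s,t)}=e\rangle$, $m(s,s)=1$, $m(s,t)\in\{2,3,\dots,\infty\}$ for $s\ne t$; simply laced: $m(s,t)\le3$; Coxeter graph $\Gamma$ on $S$ with edge $\{s,t\}$ iff $m(s,t)\ge3$; triangle free: no three-cycles in $\Gamma$. Reduced expression: minimal-length word for its element. Braid move: replace consecutive $sts$ by $tst$ with $m(s,t)=3$; braid class $[{\boldsymbol{\alpha}}]$: reduced expressions reachable from ${\boldsymbol{\alpha}}$ by braid moves; braid graph $B({\boldsymbol{\alpha}})$: vertex set $[{\boldsymbol{\alpha}}]$, edges between expressions differing by one braid move. For ${\boldsymbol{\alpha}}=s_{x_1}\cdots s_{x_m}$, $\llbracket i,i+2\rrbracket$ is a braid shadow if $s_{x_i}=s_{x_{i+2}}$ and $m(s_{x_i},s_{x_{i+1}})=3$; $\operatorname{bs}([{\boldsymbol{\alpha}}])$ is the set of braid shadows of all elements of $[{\boldsymbol{\alpha}}]$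 and $\operatorname{rank}({\boldsymbol{\alpha}})=|\operatorname{bs}([{\boldsymbol{\alpha}}])|$. A reduced expression with $m\ge1$ letters is a link if $m=1$ or $m$ is odd and $\operatorname{bs}([{\boldsymbol{\alpha}}])=\{\llbracket1,3\rrbracket,\dots,\llbracket m-2,m\rrbracket\}$; a link of rank $r$ has $2r+1$ letters. For a link ${\boldsymbol{\alpha}}$ of rank $r\ge1$, $\Phi_{{\boldsymbol{\alpha}}}:[{\boldsymbol{\alpha}}]\to\{0,1\}^r$ sends ${\boldsymbol{\gamma}}$ to $a_1\cdots a_r$ with $a_k=0$ if the letter of ${\boldsymbol{\gamma}}$ in position $2k$ equals the letter of ${\boldsymbol{\alpha}}$ in position $2k$, and $a_k=1$ otherwise; for $r=0$ it sends the unique element of $[{\boldsymbol{\alpha}}]$ to the empty string. $Q_r$: vertex set $\{0,1\}^r$, adjacent iff differing in one digit. Isometric embedding: a map preserving shortest-path distances. -}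

module Defs where

open import Data.Nat using (ℕ; zero; suc; _+_; _*_; _≤_)
open import Data.Nat.Properties using ()
open import Data.Fin using (Fin; toℕ)
open import Data.Maybe using (Maybe; just; nothing)
open import Data.Bool using (Bool; true; false; not)
open import Data.List using (List; []; _∷_; _++_; length; concat; replicate)
open import Data.List.Membership.Propositional using (_∈_)
open import Data.List.Relation.Unary.Unique.Propositional using (Unique)
open import Data.Vec using (Vec; tabulate; zipWith; foldr)
open import Data.Product using (Σ; _×_; _,_; ∃)
open import Data.Sum using (_⊎_)
open import Data.Empty using (⊥)
open import Relation.Nullary using (¬_; does)
open import Relation.Binary.PropositionalEquality using (_≡_; _≢_)
open import Relation.Binary.Construct.Closure.Equivalence using (EqClosure)
open import Relation.Binary.Construct.Closure.ReflexiveTransitive using (Star)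
open import Function.Bundles using (_⇔_)
open import Function.Definitions using (Bijective)
open import Data.Maybe.Properties using (≡-dec)
import Data.Fin.Properties as FinP

-- Coxeter matrices on S = Fin n.  m s t = nothing encodes m(s,t) = ∞.

record IsCoxeterMatrix {n : ℕ} (m : Fin n → Fin n → Maybe ℕ) : Set where
  field
    diag : ∀ s → m s s ≡ just 1
    sym  : ∀ s t → m s t ≡ m t s
    off  : ∀ s t → s ≢ t → (m s t ≡ nothing) ⊎ (Σ ℕ λ k → (m s t ≡ just k) × (2 ≤ k))

SimplyLaced : {n : ℕ} → (Fin n → Fin n → Maybe ℕ) → Set
SimplyLaced {n} m = ∀ (s t : Fin n) → Σ ℕ λ k → (m s t ≡ just k) × (k ≤ 3)

Edge : {n : ℕ} → (Fin n → Fin n → Maybe ℕ) → Fin n → Fin n → Set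
Edge m s t = (m s t ≡ nothing) ⊎ (Σ ℕ λ k → (m s t ≡ just k) × (3 ≤ k))

TriangleFree : {n : ℕ} → (Fin n → Fin n → Maybe ℕ) → Set
TriangleFree {n} m = ∀ (s t u : Fin n) → s ≢ t → t ≢ u → s ≢ u →
  ¬ (Edge m s t × Edge m t u × Edge m s u)

module Coxeter {n : ℕ} (m : Fin n → Fin n → Maybe ℕ) where

  Word : Set
  Word = List (Fin n)

  alt : Fin n → Fin n → ℕ → Word
  alt s t k = concat (replicate k (s ∷ t ∷ []))

  data Del : Word → Word → Set where
    del : ∀ (u v : Word) (s t : Fin n) (k : ℕ) → m s t ≡ just k →
          Del (u ++ alt s t k ++ v) (u ++ v)

  -- equality in W = ⟨ S ∣ (st)^{m(s,t)} = e ⟩ (monoid congruence generated by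
  -- the relators; since every generator is an involution this is the group)
  _≈W_ : Word → Word → Set
  _≈W_ = EqClosure Del

  Reduced : Word → Set
  Reduced α = ∀ β → β ≈W α → length α ≤ length β

  data BraidMove : Word → Word → Set where
    move : ∀ (u v : Word) (s t : Fin n) → m s t ≡ just 3 →
           BraidMove (u ++ s ∷ t ∷ s ∷ v) (u ++ t ∷ s ∷ t ∷ v)

  InClass : Word → Word → Set
  InClass α γ = Star BraidMove α γ

  -- letter at 1-indexed position p
  at : Word → ℕ → Maybe (Fin n)
  at []       _             = nothing
  at (x ∷ xs) zero          = nothing
  at (x ∷ xs) (suc zero)    = just x
  at (x ∷ xs) (suc (suc p)) = at xs (suc p)

  BraidShadow : Word → ℕ → Set
  BraidShadow γ i = Σ (Fin n) λ s → Σ (Fin n) λ t →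
    (1 ≤ i) × (at γ i ≡ just s) × (at γ (i + 1) ≡ just t) × (at γ (i + 2) ≡ just s)
    × (m s t ≡ just 3)

  InBS : Word → ℕ → Set
  InBS α i = Σ Word λ γ → InClass α γ × BraidShadow γ i

  -- rank(α) = |bs([α])| = r : bs([α]) is listed without repetition by a list of length r
  HasRank : Word → ℕ → Set
  HasRank α r = Σ (List ℕ) λ l → Unique l × (length l ≡ r) × (∀ i → (i ∈ l) ⇔ InBS α i)

  Odd : ℕ → Set
  Odd k = Σ ℕ λ j → k ≡ suc (j * 2)

  Link : Word → Set
  Link α = Reduced α × (1 ≤ length α) ×
    ((length α ≡ 1) ⊎
     (Odd (length α) × (∀ i → InBS α i ⇔ (Odd i × (i + 2 ≤ length α)))))

  eqb : Maybe (Fin n) → Maybe (Fin n) → Bool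
  eqb x y = does (≡-dec FinP._≟_ x y)

  Φ : Word → (r : ℕ) → Word → Vec Bool r
  Φ α r γ = tabulate λ (k : Fin r) →
    not (eqb (at γ (2 * suc (toℕ k))) (at α (2 * suc (toℕ k))))

data Walk {A : Set} (R : A → A → Set) : A → A → ℕ → Set where
  here  : ∀ {x} → Walk R x x 0
  there : ∀ {x y z k} → R x y → Walk R y z k → Walk R x z (suc k)

IsDist : {A : Set} → (A → A → Set) → A → A → ℕ → Set
IsDist R x y d = Walk R x y d × (∀ k → Walk R x y k → d ≤ k)

hamming : ∀ {r} → Vec Bool r → Vec Bool r → ℕ
hamming u v = foldr (λ _ → ℕ) (λ b acc → (if b then 1 else 0) + acc) 0
  (zipWith (λ x y → not (does (Data.Bool._≟_ x y))) u v)
  where open import Data.Bool using (if_then_else_)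
        import Data.Bool

QAdj : ∀ {r} → Vec Bool r → Vec Bool r → Set
QAdj u v = hamming u v ≡ 1

IsQAut : ∀ {r} → (Vec Bool r → Vec Bool r) → Set
IsQAut F = Bijective _≡_ _≡_ F × (∀ u v → QAdj u v ⇔ QAdj (F u) (F v))

module _ {n : ℕ} (m : Fin n → Fin n → Maybe ℕ) where
  open Coxeter m
  IsometricEmbedding : Word → (r : ℕ) → Set
  IsometricEmbedding α r = ∀ γ δ → InClass α γ → InClass α δ → ∀ d →
    IsDist BraidMove γ δ d ⇔ IsDist QAdj (Φ α r γ) (Φ α r δ) d

-- In a link every braid move of the class rewrites positions 2j+1, 2j+2, 2j+3 for some j
-- (its braid shadow must be one of ⟦1,3⟧, ⟦3,5⟧, …), so the letter at an even position 2k
-- changes only by a move centred there.  Once such a move s t s ↦ t s t has occurred, the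
-- letter at 2k stays in {s, t} throughout the class: a later move centred at 2k with a third
-- letter would need three pairwise adjacent generators, which triangle-freeness forbids.
-- Hence each even position takes at most two values on [α], so for γ ∈ [α] the k-th digit of
-- Φ_β(γ) is that of Φ_α(γ) flipped exactly when α and β differ at 2k.  Thus Φ_β = F ∘ Φ_α
-- for the translation F v = v ⊕ Φ_α(β) of Q_r, an involutive graph automorphism, and those
-- preserve distances.

module Submission where

open import Defs
open import Data.Nat using (ℕ; zero; suc; _+_; _*_; _≤_; z≤n; s≤s)
open import Data.Nat.Properties
  using (+-comm; suc-injective; *-comm; ≤-refl; ≤-trans; n≤1+n; m≤m+n; m≤n+m; +-mono-≤; +-monoʳ-≤; *-monoˡ-≤)
open import Data.Fin using (Fin; toℕ)
open import Data.Maybe using (Maybe; just)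
open import Data.Bool using (Bool; true; false; not; _xor_; if_then_else_)
import Data.Bool as Bool
open import Data.Bool.Properties using (xor-assoc; xor-same; xor-identityʳ)
open import Data.List using ([]; _∷_; _++_; length)
open import Data.List.Properties using (length-++)
open import Data.Vec using (Vec; []; _∷_; tabulate; zipWith)
open import Data.Vec.Properties using (tabulate-cong)
open import Data.Product using (Σ; _×_; _,_; proj₁; proj₂)
open import Data.Sum using (_⊎_; inj₁; inj₂; swap)
open import Data.Empty using (⊥; ⊥-elim)
open import Relation.Nullary using (does)
open import Relation.Nullary.Decidable using (dec-true; does-⇔)
open import Relation.Binary.PropositionalEquality
  using (_≡_; _≢_; refl; sym; trans; cong; cong₂; subst; subst₂; module ≡-Reasoning)
open import Relation.Binary.Construct.Closure.ReflexiveTransitive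
  using (Star; ε; _◅_; _◅◅_; reverse)
open import Function.Bundles using (_⇔_; mk⇔; Equivalence)
open import Function.Definitions using (Bijective)
open import Function.Consequences.Propositional
  using (inverseᵇ⇒bijective; strictlyInverseˡ⇒inverseˡ; strictlyInverseʳ⇒inverseʳ)
open import Data.Maybe.Properties using (≡-dec)
import Data.Fin as Fin
import Data.Fin.Properties as FinP

module _ {A : Set} {R : A → A → Set} (F : A → A)
         (F-involutive : ∀ x → F (F x) ≡ x)
         (F-preserves : ∀ x y → R x y → R (F x) (F y)) where

  Walk-map : ∀ {x y k} → Walk R x y k → Walk R (F x) (F y) k
  Walk-map here                = here
  Walk-map (there {x} {y} e w) = there (F-preserves x y e) (Walk-map w)

  IsDist-map : ∀ {x y d} → IsDist R x y d → IsDist R (F x) (F y) d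
  IsDist-map {x} {y} (w , shortest) = Walk-map w , λ k w′ → shortest k (unmap w′)
    where
      unmap : ∀ {k} → Walk R (F x) (F y) k → Walk R x y k
      unmap {k} w′ = subst₂ (λ a b → Walk R a b k) (F-involutive x) (F-involutive y) (Walk-map w′)

  IsDist-unmap : ∀ {x y d} → IsDist R (F x) (F y) d → IsDist R x y d
  IsDist-unmap {x} {y} {d} h =
    subst₂ (λ a b → IsDist R a b d) (F-involutive x) (F-involutive y) (IsDist-map h)

involutive⇒bijective : ∀ {A : Set} {F : A → A} → (∀ x → F (F x) ≡ x) → Bijective _≡_ _≡_ F
involutive⇒bijective {F = F} inv =
  inverseᵇ⇒bijective (strictlyInverseˡ⇒inverseˡ F inv , strictlyInverseʳ⇒inverseʳ F inv)

xorᵥ : ∀ {r} → Vec Bool r → Vec Bool r → Vec Bool r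
xorᵥ = zipWith _xor_

xorᵥ-involutive : ∀ {r} (c v : Vec Bool r) → xorᵥ c (xorᵥ c v) ≡ v
xorᵥ-involutive []       []       = refl
xorᵥ-involutive (c ∷ cs) (x ∷ xs) =
  cong₂ _∷_ (trans (sym (xor-assoc c c x)) (cong (_xor x) (xor-same c))) (xorᵥ-involutive cs xs)

xor-differs : ∀ c x y → not (does (c xor x Bool.≟ c xor y)) ≡ not (does (x Bool.≟ y))
xor-differs false x     y     = refl
xor-differs true  false false = refl
xor-differs true  false true  = refl
xor-differs true  true  false = refl
xor-differs true  true  true  = refl

hamming-xorᵥ : ∀ {r} (c u v : Vec Bool r) → hamming (xorᵥ c u) (xorᵥ c v) ≡ hamming u v
hamming-xorᵥ []       []       []       = refl
hamming-xorᵥ (c ∷ cs) (x ∷ u) (y ∷ v) =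
  cong₂ (λ b h → (if b then 1 else 0) + h) (xor-differs c x y) (hamming-xorᵥ cs u v)

QAdj-xorᵥ : ∀ {r} (c : Vec Bool r) u v → QAdj u v → QAdj (xorᵥ c u) (xorᵥ c v)
QAdj-xorᵥ c u v adj = trans (hamming-xorᵥ c u v) adj

xorᵥ-isQAut : ∀ {r} (c : Vec Bool r) → IsQAut (xorᵥ c)
xorᵥ-isQAut c = involutive⇒bijective (xorᵥ-involutive c) , λ u v → mk⇔ (QAdj-xorᵥ c u v) (reflect u v)
  where
    reflect : ∀ u v → QAdj (xorᵥ c u) (xorᵥ c v) → QAdj u v
    reflect u v adj = trans (sym (hamming-xorᵥ c u v)) adj

zipWith-tabulate : ∀ {A B C : Set} {r} (_∙_ : A → B → C) (f : Fin r → A) (g : Fin r → B) →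
                   zipWith _∙_ (tabulate f) (tabulate g) ≡ tabulate (λ k → f k ∙ g k)
zipWith-tabulate {r = zero}  _∙_ f g = refl
zipWith-tabulate {r = suc r} _∙_ f g =
  cong (f Fin.zero ∙ g Fin.zero ∷_) (zipWith-tabulate _∙_ (λ k → f (Fin.suc k)) (λ k → g (Fin.suc k)))

pair-pigeonhole : ∀ {A : Set} {a b x y z : A} → x ≡ a ⊎ x ≡ b → y ≡ a ⊎ y ≡ b → z ≡ a ⊎ z ≡ b →
                  x ≡ y ⊎ x ≡ z ⊎ y ≡ z
pair-pigeonhole (inj₁ refl) (inj₁ refl) _           = inj₁ refl
pair-pigeonhole (inj₂ refl) (inj₂ refl) _           = inj₁ refl
pair-pigeonhole (inj₁ refl) (inj₂ refl) (inj₁ refl) = inj₂ (inj₁ refl)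
pair-pigeonhole (inj₂ refl) (inj₁ refl) (inj₂ refl) = inj₂ (inj₁ refl)
pair-pigeonhole (inj₁ refl) (inj₂ refl) (inj₂ refl) = inj₂ (inj₂ refl)
pair-pigeonhole (inj₂ refl) (inj₁ refl) (inj₁ refl) = inj₂ (inj₂ refl)

data Offset : ℕ → ℕ → Set where
  far-before  : ∀ j d → Offset j (2 + (j + d))
  just-before : ∀ j → Offset j (suc j)
  same-block  : ∀ j → Offset j j
  just-after  : ∀ q → Offset (suc q) q
  far-after   : ∀ q d → Offset (2 + (q + d)) q

offset : ∀ j q → Offset j q
offset zero          zero          = same-block zero
offset zero          (suc zero)    = just-before zero
offset zero          (suc (suc q)) = far-before zero q
offset (suc zero)    zero          = just-after zero
offset (suc (suc j)) zero          = far-after zero j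
offset (suc j)       (suc q) with offset j q
... | far-before _ d  = far-before (suc j) d
... | just-before _   = just-before (suc j)
... | same-block _    = same-block (suc j)
... | just-after _    = just-after (suc q)
... | far-after _ d   = far-after (suc q) d

module Positions {n : ℕ} (m : Fin n → Fin n → Maybe ℕ) where
  open Coxeter m

  at-++ˡ : ∀ (u w : Word) {p} → p ≤ length u → at (u ++ w) p ≡ at u p
  at-++ˡ []      []      z≤n                    = refl
  at-++ˡ []      (_ ∷ _) z≤n                    = refl
  at-++ˡ (_ ∷ _) w       {zero}        _        = refl
  at-++ˡ (_ ∷ _) w       {suc zero}    _        = refl
  at-++ˡ (_ ∷ u) w       {suc (suc p)} (s≤s le) = at-++ˡ u w le

  at-++ʳ : ∀ (u w : Word) i → at (u ++ w) (suc (length u + i)) ≡ at w (suc i)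
  at-++ʳ []      w i = refl
  at-++ʳ (_ ∷ u) w i = at-++ʳ u w i

  at-past-block : ∀ (u : Word) {a b c a′ b′ c′ : Fin n} {v p} → 4 + length u ≤ p →
                at (u ++ a ∷ b ∷ c ∷ v) p ≡ at (u ++ a′ ∷ b′ ∷ c′ ∷ v) p
  at-past-block []      (s≤s (s≤s (s≤s (s≤s _)))) = refl
  at-past-block (_ ∷ u) (s≤s le@(s≤s _))           = at-past-block u le

  BraidShadow-∷ : ∀ x γ i → BraidShadow γ (suc i) → BraidShadow (x ∷ γ) (suc (suc i))
  BraidShadow-∷ x γ i (s , t , _ , l₀ , l₁ , l₂ , a) = s , t , s≤s z≤n , l₀ , l₁ , l₂ , a

  braid-site-shadow : ∀ (u v : Word) {s t} → m s t ≡ just 3 →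
                      BraidShadow (u ++ s ∷ t ∷ s ∷ v) (suc (length u))
  braid-site-shadow []      v a = _ , _ , s≤s z≤n , refl , refl , refl , a
  braid-site-shadow (x ∷ u) v a = BraidShadow-∷ x (u ++ _) (length u) (braid-site-shadow u v a)

  braid-site-length : ∀ (u : Word) {a b c : Fin n} {v} → length (u ++ a ∷ b ∷ c ∷ v) ≢ 1
  braid-site-length []          ()
  braid-site-length (_ ∷ [])    ()
  braid-site-length (_ ∷ _ ∷ _) ()

module BraidMoves {n : ℕ} {m : Fin n → Fin n → Maybe ℕ} (cox : IsCoxeterMatrix m) where
  open Coxeter m
  open Positions m

  braid-sym : ∀ {s t} → m s t ≡ just 3 → m t s ≡ just 3
  braid-sym {s} {t} a = trans (IsCoxeterMatrix.sym cox t s) a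

  braid-≢ : ∀ {s t} → m s t ≡ just 3 → s ≢ t
  braid-≢ {s} a refl with trans (sym (IsCoxeterMatrix.diag cox s)) a
  ... | ()

  no-braid-triangle : TriangleFree m → ∀ {s t u} →
                      m s t ≡ just 3 → m t u ≡ just 3 → m s u ≡ just 3 → ⊥
  no-braid-triangle tf a b c = tf _ _ _ (braid-≢ a) (braid-≢ b) (braid-≢ c) (edge a , edge b , edge c)
    where
      edge : ∀ {s t} → m s t ≡ just 3 → Edge m s t
      edge a = inj₂ (3 , a , ≤-refl)

  BraidMove-sym : ∀ {x y} → BraidMove x y → BraidMove y x
  BraidMove-sym (move u v s t a) = move u v t s (braid-sym a)

  InClass-connected : ∀ {α γ δ} → InClass α γ → InClass α δ → Star BraidMove γ δ
  InClass-connected γ∈ δ∈ = reverse BraidMove-sym γ∈ ◅◅ δ∈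

  BraidMoves-length : ∀ {x y} → Star BraidMove x y → length x ≡ length y
  BraidMoves-length ε = refl
  BraidMoves-length (move u v s t a ◅ path) =
    trans (trans (length-++ u) (sym (length-++ u))) (BraidMoves-length path)

  braid-site-even : ∀ {α u v s t} → Link α → InClass α (u ++ s ∷ t ∷ s ∷ v) → m s t ≡ just 3 →
                    Σ ℕ λ j → length u ≡ j * 2
  braid-site-even {u = u} (_ , _ , inj₁ length≡1) γ∈ _ =
    ⊥-elim (braid-site-length u (trans (sym (BraidMoves-length γ∈)) length≡1))
  braid-site-even {u = u} {v} (_ , _ , inj₂ (_ , shadows)) γ∈ a
    with Equivalence.to (shadows (suc (length u))) (_ , γ∈ , braid-site-shadow u v a)
  ... | (j , odd) , _ = j , suc-injective odd

module Windows {n : ℕ} (m : Fin n → Fin n → Maybe ℕ) where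
  open Coxeter m
  open Positions m

  Letter : Set
  Letter = Maybe (Fin n)

  Window : Set
  Window = Vec Letter 5

  -- positions 2q, …, 2q+4 around the even position 2q+2; position 0 reads as nothing
  window : ℕ → Word → Window
  window q δ = at δ (q * 2) ∷ at δ (1 + q * 2) ∷ at δ (2 + q * 2) ∷ at δ (3 + q * 2) ∷ at δ (4 + q * 2) ∷ []

  centre : Window → Letter
  centre (_ ∷ _ ∷ x ∷ _ ∷ _ ∷ []) = x

  data WindowStep : Window → Window → Set where
    unchanged   : ∀ {w} → WindowStep w w
    left-step   : ∀ {s t x₂ x₃ x₄} → m s t ≡ just 3 →
                  WindowStep (just t ∷ just s ∷ x₂ ∷ x₃ ∷ x₄ ∷ []) (just s ∷ just t ∷ x₂ ∷ x₃ ∷ x₄ ∷ [])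
    centre-step : ∀ {s t x₀ x₄} → m s t ≡ just 3 →
                  WindowStep (x₀ ∷ just s ∷ just t ∷ just s ∷ x₄ ∷ []) (x₀ ∷ just t ∷ just s ∷ just t ∷ x₄ ∷ [])
    right-step  : ∀ {s t x₀ x₁ x₂} → m s t ≡ just 3 →
                  WindowStep (x₀ ∷ x₁ ∷ x₂ ∷ just s ∷ just t ∷ []) (x₀ ∷ x₁ ∷ x₂ ∷ just t ∷ just s ∷ [])

  CentredShadow : Window → Set
  CentredShadow (_ ∷ x₁ ∷ x₂ ∷ x₃ ∷ _ ∷ []) =
    Σ (Fin n) λ s → Σ (Fin n) λ t → m s t ≡ just 3 × x₁ ≡ just s × x₂ ≡ just t × x₃ ≡ just s

  WindowStep-centre : ∀ {w w′} → WindowStep w w′ → centre w′ ≡ centre w ⊎ CentredShadow w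
  WindowStep-centre unchanged       = inj₁ refl
  WindowStep-centre (left-step _)   = inj₁ refl
  WindowStep-centre (right-step _)  = inj₁ refl
  WindowStep-centre (centre-step a) = inj₂ (_ , _ , a , refl , refl , refl)

  private
    window-≡ : ∀ q δ δ′ → (∀ {i} → i ≤ 4 → at δ (i + q * 2) ≡ at δ′ (i + q * 2)) →
               window q δ ≡ window q δ′
    window-≡ q δ δ′ h = cong₂ _∷_ (h z≤n) (cong₂ _∷_ (h (s≤s z≤n)) (cong₂ _∷_ (h (s≤s (s≤s z≤n)))
                        (cong₂ _∷_ (h (s≤s (s≤s (s≤s z≤n)))) (cong₂ _∷_ (h ≤-refl) refl))))

    left-step′ : ∀ {s t x₀ x₁ x₂ x₃ x₄ y₀ y₁ y₂ y₃ y₄} → m s t ≡ just 3 →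
                 x₀ ≡ just t → x₁ ≡ just s → y₀ ≡ just s → y₁ ≡ just t → x₂ ≡ y₂ → x₃ ≡ y₃ → x₄ ≡ y₄ →
                 WindowStep (x₀ ∷ x₁ ∷ x₂ ∷ x₃ ∷ x₄ ∷ []) (y₀ ∷ y₁ ∷ y₂ ∷ y₃ ∷ y₄ ∷ [])
    left-step′ a refl refl refl refl refl refl refl = left-step a

    centre-step′ : ∀ {s t x₀ x₁ x₂ x₃ x₄ y₀ y₁ y₂ y₃ y₄} → m s t ≡ just 3 →
                   x₁ ≡ just s → x₂ ≡ just t → x₃ ≡ just s → y₁ ≡ just t → y₂ ≡ just s → y₃ ≡ just t →
                   x₀ ≡ y₀ → x₄ ≡ y₄ → WindowStep (x₀ ∷ x₁ ∷ x₂ ∷ x₃ ∷ x₄ ∷ []) (y₀ ∷ y₁ ∷ y₂ ∷ y₃ ∷ y₄ ∷ [])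
    centre-step′ a refl refl refl refl refl refl refl refl = centre-step a

    right-step′ : ∀ {s t x₀ x₁ x₂ x₃ x₄ y₀ y₁ y₂ y₃ y₄} → m s t ≡ just 3 →
                  x₃ ≡ just s → x₄ ≡ just t → y₃ ≡ just t → y₄ ≡ just s → x₀ ≡ y₀ → x₁ ≡ y₁ → x₂ ≡ y₂ →
                  WindowStep (x₀ ∷ x₁ ∷ x₂ ∷ x₃ ∷ x₄ ∷ []) (y₀ ∷ y₁ ∷ y₂ ∷ y₃ ∷ y₄ ∷ [])
    right-step′ a refl refl refl refl refl refl refl = right-step a

  module _ (q : ℕ) (u v : Word) {s t : Fin n} (a : m s t ≡ just 3) (j : ℕ) (len : length u ≡ j * 2) where
    private
      σ τ : Word
      σ = s ∷ t ∷ s ∷ v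
      τ = t ∷ s ∷ t ∷ v

      inside : ∀ w i → at (u ++ w) (suc (i + j * 2)) ≡ at w (suc i)
      inside w i rewrite sym len | +-comm i (length u) = at-++ʳ u w i

      before : ∀ {p} → p ≤ j * 2 → at (u ++ σ) p ≡ at (u ++ τ) p
      before le rewrite sym len = trans (at-++ˡ u σ le) (sym (at-++ˡ u τ le))

      after : ∀ {p} → 4 + j * 2 ≤ p → at (u ++ σ) p ≡ at (u ++ τ) p
      after le rewrite sym len = at-past-block u le

    braid-windowStep : WindowStep (window q (u ++ σ)) (window q (u ++ τ))
    braid-windowStep with offset j q
    ... | same-block _ = centre-step′ a (inside σ 0) (inside σ 1) (inside σ 2)
                           (inside τ 0) (inside τ 1) (inside τ 2) (before ≤-refl) (after ≤-refl)
    ... | just-before _ = left-step′ a (inside σ 1) (inside σ 2) (inside τ 1) (inside τ 2)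
                            (after ≤-refl) (after (n≤1+n _)) (after (≤-trans (n≤1+n _) (n≤1+n _)))
    ... | just-after q = right-step′ a (inside σ 0) (inside σ 1) (inside τ 0) (inside τ 1)
                           (before (m≤n+m _ 2)) (before (m≤n+m _ 1)) (before ≤-refl)
    ... | far-before _ d = subst (WindowStep _) (window-≡ q (u ++ σ) (u ++ τ) λ {i} _ → after
                             (≤-trans (+-monoʳ-≤ 4 (*-monoˡ-≤ 2 (m≤m+n j d))) (m≤n+m _ i))) unchanged
    ... | far-after q d = subst (WindowStep _) (window-≡ q (u ++ σ) (u ++ τ) λ i≤4 → before
                            (+-mono-≤ i≤4 (*-monoˡ-≤ 2 (m≤m+n q d)))) unchanged

module TwoLetterInvariant {n : ℕ} {m : Fin n → Fin n → Maybe ℕ} (cox : IsCoxeterMatrix m) (tf : TriangleFree m) where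
  open Windows m
  open BraidMoves cox

  Guarded : Fin n → Letter → Letter → Set
  Guarded c outer inner = inner ≡ just c ⊎ (outer ≡ just c × Σ (Fin n) λ y → inner ≡ just y × m y c ≡ just 3)

  -- Holds right after a centred move turns c′ into c and survives the moves beside the
  -- window; a further centred move can only turn c back into c′.
  Toggle : Fin n → Fin n → Window → Set
  Toggle c c′ (x₀ ∷ x₁ ∷ x₂ ∷ x₃ ∷ x₄ ∷ []) = x₂ ≡ just c × Guarded c′ x₀ x₁ × Guarded c′ x₄ x₃

  Guarded-swap : ∀ {s t c} → m s t ≡ just 3 → Guarded c (just t) (just s) → Guarded c (just s) (just t)
  Guarded-swap a (inj₁ refl)       = inj₂ (refl , _ , refl , braid-sym a)
  Guarded-swap a (inj₂ (refl , _)) = inj₁ refl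

  Toggle-step : ∀ {c c′ w w′} → m c c′ ≡ just 3 → WindowStep w w′ →
                Toggle c c′ w → Toggle c c′ w′ ⊎ Toggle c′ c w′
  Toggle-step _   unchanged       inv            = inj₁ inv
  Toggle-step _   (left-step a)   (x₂ , gˡ , gʳ) = inj₁ (x₂ , Guarded-swap a gˡ , gʳ)
  Toggle-step _   (right-step a)  (x₂ , gˡ , gʳ) = inj₁ (x₂ , gˡ , Guarded-swap a gʳ)
  Toggle-step _   (centre-step a) (refl , inj₁ refl , _) = inj₂ (refl , inj₁ refl , inj₁ refl)
  Toggle-step cc′ (centre-step a) (refl , inj₂ (_ , _ , refl , b) , _) = ⊥-elim (no-braid-triangle tf a cc′ b)

  TwoLetters : Fin n → Fin n → Window → Set
  TwoLetters c c′ w = Toggle c c′ w ⊎ Toggle c′ c w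

  TwoLetters-step : ∀ {c c′ w w′} → m c c′ ≡ just 3 → WindowStep w w′ →
                    TwoLetters c c′ w → TwoLetters c c′ w′
  TwoLetters-step cc′ step (inj₁ inv) = Toggle-step cc′ step inv
  TwoLetters-step cc′ step (inj₂ inv) = swap (Toggle-step (braid-sym cc′) step inv)

  TwoLetters-centre : ∀ {c c′} w → TwoLetters c c′ w → centre w ≡ just c ⊎ centre w ≡ just c′
  TwoLetters-centre (_ ∷ _ ∷ _ ∷ _ ∷ _ ∷ []) (inj₁ (x₂ , _)) = inj₁ x₂
  TwoLetters-centre (_ ∷ _ ∷ _ ∷ _ ∷ _ ∷ []) (inj₂ (x₂ , _)) = inj₂ x₂

  CentredShadow⇒TwoLetters : ∀ w → CentredShadow w →
                             Σ (Fin n) λ c → Σ (Fin n) λ c′ → m c c′ ≡ just 3 × TwoLetters c c′ w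
  CentredShadow⇒TwoLetters (_ ∷ _ ∷ _ ∷ _ ∷ _ ∷ []) (_ , _ , a , x₁ , x₂ , x₃) =
    _ , _ , braid-sym a , inj₁ (x₂ , inj₁ x₁ , inj₁ x₃)

module LinkBraidClass {n : ℕ} {m : Fin n → Fin n → Maybe ℕ} (cox : IsCoxeterMatrix m) (tf : TriangleFree m)
                      {α : Coxeter.Word m} (α-link : Coxeter.Link m α) where
  open Coxeter m
  open Positions m
  open Windows m
  open BraidMoves cox
  open TwoLetterInvariant cox tf

  class-windowStep : ∀ q {δ δ′} → InClass α δ → BraidMove δ δ′ → WindowStep (window q δ) (window q δ′)
  class-windowStep q δ∈ (move u v s t a) with braid-site-even α-link δ∈ a
  ... | j , len = braid-windowStep q u v a j len

  window-invariant : ∀ (P : Window → Set) → (∀ {w w′} → WindowStep w w′ → P w → P w′) →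
                     ∀ q {δ δ′} → InClass α δ → Star BraidMove δ δ′ → P (window q δ) → P (window q δ′)
  window-invariant P step q δ∈ ε             p = p
  window-invariant P step q δ∈ (mv ◅ moves) p =
    window-invariant P step q (δ∈ ◅◅ mv ◅ ε) moves (step (class-windowStep q δ∈ mv) p)

  centre-stable-or-shadow : ∀ q {δ δ′} → InClass α δ → Star BraidMove δ δ′ →
                            centre (window q δ′) ≡ centre (window q δ)
                            ⊎ Σ Word λ γ → InClass α γ × CentredShadow (window q γ)
  centre-stable-or-shadow q δ∈ ε = inj₁ refl
  centre-stable-or-shadow q δ∈ (mv ◅ moves) with WindowStep-centre (class-windowStep q δ∈ mv)
  ... | inj₂ shadow = inj₂ (_ , δ∈ , shadow)
  ... | inj₁ same with centre-stable-or-shadow q (δ∈ ◅◅ mv ◅ ε) moves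
  ...   | inj₁ same′ = inj₁ (trans same′ same)
  ...   | inj₂ found = inj₂ found

  even-letter-pigeonhole : ∀ q {γ β} → InClass α γ → InClass α β →
                           let p = 2 + q * 2 in at γ p ≡ at α p ⊎ at γ p ≡ at β p ⊎ at α p ≡ at β p
  even-letter-pigeonhole q γ∈ β∈ with centre-stable-or-shadow q ε γ∈
  ... | inj₁ same = inj₁ same
  ... | inj₂ (γ₀ , γ₀∈ , shadow) with CentredShadow⇒TwoLetters (window q γ₀) shadow
  ...   | c , c′ , cc′ , two = pair-pigeonhole (letter γ∈) (letter ε) (letter β∈)
    where
      letter : ∀ {δ} → InClass α δ → at δ (2 + q * 2) ≡ just c ⊎ at δ (2 + q * 2) ≡ just c′
      letter {δ} δ∈ = TwoLetters-centre (window q δ)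
        (window-invariant (TwoLetters c c′) (TwoLetters-step cc′) q γ₀∈ (InClass-connected γ₀∈ δ∈) two)

module _ {n : ℕ} {m : Fin n → Fin n → Maybe ℕ} where
  open Coxeter m

  eqb-refl : ∀ x → eqb x x ≡ true
  eqb-refl x = dec-true (≡-dec FinP._≟_ x x) refl

  eqb-sym : ∀ x y → eqb x y ≡ eqb y x
  eqb-sym x y = does-⇔ (mk⇔ sym sym) (≡-dec FinP._≟_ x y) (≡-dec FinP._≟_ y x)

  differs-xor : ∀ {x y z} → x ≡ y ⊎ x ≡ z ⊎ y ≡ z → not (eqb z y) xor not (eqb x y) ≡ not (eqb x z)
  differs-xor {x} {z = z} (inj₁ refl) rewrite eqb-refl x = trans (xor-identityʳ _) (cong not (eqb-sym z x))
  differs-xor {x} {y}     (inj₂ (inj₁ refl)) rewrite eqb-refl x = xor-same (not (eqb x y))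
  differs-xor {y = y}     (inj₂ (inj₂ refl)) rewrite eqb-refl y = refl

  isometric-transfer : ∀ {α β r} (F : Vec Bool r → Vec Bool r) → (∀ x → F (F x) ≡ x) →
                       (∀ u v → QAdj u v → QAdj (F u) (F v)) →
                       (∀ {γ} → InClass β γ → InClass α γ × F (Φ α r γ) ≡ Φ β r γ) →
                       IsometricEmbedding m α r → IsometricEmbedding m β r
  isometric-transfer {α} {β} {r} F F-inv F-adj β⊆α embedding γ δ γ∈ δ∈ d = mk⇔ to from
    where
      open Equivalence (embedding γ δ (β⊆α γ∈ .proj₁) (β⊆α δ∈ .proj₁) d)
        renaming (to to toα; from to fromα)
      DistQ : Vec Bool r → Vec Bool r → Set
      DistQ x y = IsDist QAdj x y d
      to : IsDist BraidMove γ δ d → DistQ (Φ β r γ) (Φ β r δ)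
      to h = subst₂ DistQ (β⊆α γ∈ .proj₂) (β⊆α δ∈ .proj₂) (IsDist-map F F-inv F-adj (toα h))
      from : DistQ (Φ β r γ) (Φ β r δ) → IsDist BraidMove γ δ d
      from h = fromα (IsDist-unmap F F-inv F-adj (subst₂ DistQ (sym (β⊆α γ∈ .proj₂)) (sym (β⊆α δ∈ .proj₂)) h))

module _ {n : ℕ} {m : Fin n → Fin n → Maybe ℕ} (cox : IsCoxeterMatrix m) (tf : TriangleFree m)
         {α : Coxeter.Word m} (α-link : Coxeter.Link m α) where
  open Coxeter m
  open LinkBraidClass cox tf α-link

  Φ-translate : ∀ {β γ} r → InClass α β → InClass α γ → xorᵥ (Φ α r β) (Φ α r γ) ≡ Φ β r γ
  Φ-translate {β} {γ} r β∈ γ∈ = begin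
    xorᵥ (Φ α r β) (Φ α r γ)                                ≡⟨ zipWith-tabulate _xor_ _ _ ⟩
    tabulate (λ k → not (eqb (letter β k) (letter α k)) xor not (eqb (letter γ k) (letter α k)))
                                                            ≡⟨ tabulate-cong (λ k → differs-xor {m = m} (pigeonhole k)) ⟩
    Φ β r γ                                                 ∎
    where
      open ≡-Reasoning
      letter : Word → Fin r → Maybe (Fin n)
      letter δ k = at δ (2 * suc (toℕ k))
      pigeonhole : ∀ k → letter γ k ≡ letter α k ⊎ letter γ k ≡ letter β k ⊎ letter α k ≡ letter β k
      pigeonhole k rewrite *-comm 2 (suc (toℕ k)) = even-letter-pigeonhole (toℕ k) γ∈ β∈

lemma5p13 : (n : ℕ) (m : Fin n → Fin n → Maybe ℕ) → IsCoxeterMatrix m → SimplyLaced m → TriangleFree m →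
    (α β : Coxeter.Word m) (r : ℕ) →
    Coxeter.Link m α → Coxeter.Link m β → Coxeter.InClass m α β →
    Coxeter.HasRank m α r → Coxeter.HasRank m β r →
    Σ (Vec Bool r → Vec Bool r) (λ F → IsQAut F ×
        (∀ γ → Coxeter.InClass m α γ → F (Coxeter.Φ m α r γ) ≡ Coxeter.Φ m β r γ))
    × (IsometricEmbedding m α r ⇔ IsometricEmbedding m β r)
lemma5p13 n m cox _ tf α β r α-link _ β∈ _ _ =
  (F , xorᵥ-isQAut c , λ γ γ∈ → Φ-translate cox tf α-link r β∈ γ∈) ,
  mk⇔ (isometric-transfer F F-inv (QAdj-xorᵥ c) α→β) (isometric-transfer F F-inv (QAdj-xorᵥ c) β→α)
  where
    open Coxeter m
    open BraidMoves cox
    c : Vec Bool r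
    c = Φ α r β
    F : Vec Bool r → Vec Bool r
    F = xorᵥ c
    F-inv : ∀ x → F (F x) ≡ x
    F-inv = xorᵥ-involutive c
    α→β : ∀ {γ} → InClass β γ → InClass α γ × F (Φ α r γ) ≡ Φ β r γ
    α→β γ∈ = β∈ ◅◅ γ∈ , Φ-translate cox tf α-link r β∈ (β∈ ◅◅ γ∈)
    β→α : ∀ {γ} → InClass α γ → InClass β γ × F (Φ β r γ) ≡ Φ α r γ
    β→α γ∈ = InClass-connected β∈ γ∈ , trans (cong F (sym (Φ-translate cox tf α-link r β∈ γ∈))) (F-inv _)
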